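{- Let $G$ be a finite connected loopless multigraph on $n$ vertices such that every pair of vertices joined by at least one edge is joined by at least two edges. Then $\operatorname{mfgon}(G)=n$.
   Context: A divisor is an integer combination $D=\sum_vD(v)(v)$ of vertices, degree $\sum_vD(v)$, effective if all $D(v)\ge0$. Divisors are equivalent if their difference lies in the integer column space of the Laplacian. The rank $r(D)$ is $-1$ if $D$ is not equivalent to an effective divisor, else the largest $r\ge0$ such that $D-E$ is equivalent to an effective divisor for all effective $E$ of degree $r$. $\operatorname{mfgon}(G)$ is the minimum degree of a positive-rank effective divisor $D$ with $D(v)\le1$ for all $v$. -}

module Defs where

open import Data.Nat as ℕ using (ℕ; zero; suc)
open import Data.Fin using (Fin; zero; suc)
open import Data.Fin.Properties using (_≟_)
open import Data.Integer as ℤ using (ℤ; +_; _+_; _-_; _*_; 0ℤ; 1ℤ)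
open import Data.Product using (Σ; ∃; _×_)
open import Relation.Nullary using (¬_; yes; no)
open import Relation.Binary.PropositionalEquality using (_≡_)

-- A finite loopless multigraph on the vertex set Fin n, given by its
-- (symmetric) edge-multiplicity function; mult u v = number of edges u–v.
record Multigraph (n : ℕ) : Set where
  field
    mult     : Fin n → Fin n → ℕ
    symm     : ∀ u v → mult u v ≡ mult v u
    loopless : ∀ v → mult v v ≡ 0
open Multigraph public

Σℤ : ∀ {n} → (Fin n → ℤ) → ℤ
Σℤ {zero}  f = 0ℤ
Σℤ {suc n} f = f zero + Σℤ (λ i → f (suc i))

Σℕ : ∀ {n} → (Fin n → ℕ) → ℕ
Σℕ {zero}  f = 0
Σℕ {suc n} f = f zero ℕ.+ Σℕ (λ i → f (suc i))

data Reach {n : ℕ} (G : Multigraph n) : Fin n → Fin n → Set where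
  here : ∀ {v} → Reach G v v
  step : ∀ {u w v} → 1 ℕ.≤ mult G u w → Reach G w v → Reach G u v

Connected : ∀ {n} → Multigraph n → Set
Connected {n} G = 1 ℕ.≤ n × (∀ u v → Reach G u v)

valence : ∀ {n} → Multigraph n → Fin n → ℕ
valence G v = Σℕ (mult G v)

Laplacian : ∀ {n} → Multigraph n → Fin n → Fin n → ℤ
Laplacian G v u with v ≟ u
... | yes _ = + valence G v - + mult G v u
... | no  _ = 0ℤ - + mult G v u

Divisor : ℕ → Set
Divisor n = Fin n → ℤ

deg : ∀ {n} → Divisor n → ℤ
deg D = Σℤ D

Effective : ∀ {n} → Divisor n → Set
Effective D = ∀ v → 0ℤ ℤ.≤ D v

_-ᴰ_ : ∀ {n} → Divisor n → Divisor n → Divisor n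
(D -ᴰ E) v = D v - E v

applyLap : ∀ {n} → Multigraph n → (Fin n → ℤ) → Divisor n
applyLap G f v = Σℤ (λ u → Laplacian G v u * f u)

Equiv : ∀ {n} → Multigraph n → Divisor n → Divisor n → Set
Equiv G D D' = ∃ λ f → ∀ v → (D -ᴰ D') v ≡ applyLap G f v

EquivEffective : ∀ {n} → Multigraph n → Divisor n → Set
EquivEffective G D = ∃ λ D' → Effective D' × Equiv G D D'

RankAtLeast : ∀ {n} → Multigraph n → Divisor n → ℕ → Set
RankAtLeast G D r =
  ∀ E → Effective E → deg E ≡ + r → EquivEffective G (D -ᴰ E)

-- r(D) ≥ 1 : D is equivalent to an effective divisor (r(D) ≠ −1) and the
-- defining property holds at r = 1 (the property is downward closed)
PositiveRank : ∀ {n} → Multigraph n → Divisor n → Set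
PositiveRank G D = EquivEffective G D × RankAtLeast G D 1

ZeroOne : ∀ {n} → Divisor n → Set
ZeroOne D = ∀ v → (0ℤ ℤ.≤ D v) × (D v ℤ.≤ 1ℤ)

MfgonCandidate : ∀ {n} → Multigraph n → Divisor n → Set
MfgonCandidate G D = ZeroOne D × PositiveRank G D

MfgonIs : ∀ {n} → Multigraph n → ℕ → Set
MfgonIs G k =
  (∃ λ D → MfgonCandidate G D × deg D ≡ + k)
  × (∀ D → MfgonCandidate G D → + k ℤ.≤ deg D)

-- The all-ones divisor has positive rank, since subtracting a single chip
-- leaves it effective; this gives mfgon(G) ≤ n. Conversely let D be a 0/1
-- divisor of positive rank with D(v) = 0, so that D − (v) − D' = L f for some
-- effective D' and integer vector f. At a vertex w where f is maximal,
-- (L f)(w) = Σ_u mult(w,u) (f(w) − f(u)) ≥ 0. If v is such a vertex this is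
-- impossible since (D − (v) − D')(v) < 0. Otherwise, walking from a maximum to v
-- we meet an edge w–x with f(w) maximal and f(x) < f(w); since every edge has
-- multiplicity at least 2, (L f)(w) ≥ 2 > 1 ≥ (D − (v) − D')(w). Hence every
-- such divisor is all ones, and mfgon(G) = n.
module Submission where

open import Defs
open import Data.Nat as ℕ using (ℕ; zero; suc; _≤_)
open import Data.Fin using (Fin; zero; suc)
open import Data.Fin.Properties using (_≟_; suc-injective)
open import Data.Integer as ℤ using (ℤ; +_; _+_; _-_; _*_; -_; 0ℤ; 1ℤ)
import Data.Integer.Properties as ℤP
open import Data.Integer.Tactic.RingSolver using (solve-∀)
open import Algebra.Bundles using (AbelianGroup)
open import Algebra.Properties.Group (AbelianGroup.group ℤP.+-0-abelianGroup)
  using (∙-cancelʳ)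
open import Data.List using (allFin)
open import Data.List.Relation.Unary.All using (lookup)
open import Data.List.Membership.Propositional.Properties using (∈-allFin)
open import Data.List.Extrema ℤP.≤-totalOrder using (argmax; f[xs]≤f[argmax])
open import Data.Product using (∃₂; _×_; _,_; proj₁; proj₂)
open import Data.Empty using (⊥-elim)
open import Function using (_∘_)
open import Relation.Nullary using (¬_; Dec; yes; no)
open import Relation.Unary using (Pred; Decidable)
open import Relation.Binary.PropositionalEquality

private
  variable
    n : ℕ

Σℤ-cong : {f g : Fin n → ℤ} → (∀ i → f i ≡ g i) → Σℤ f ≡ Σℤ g
Σℤ-cong {zero}  f≗g = refl
Σℤ-cong {suc n} f≗g = cong₂ _+_ (f≗g zero) (Σℤ-cong (λ i → f≗g (suc i)))

Σℤ-distrib-+ : (f g : Fin n → ℤ) → Σℤ (λ i → f i + g i) ≡ Σℤ f + Σℤ g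
Σℤ-distrib-+ {zero}  f g = refl
Σℤ-distrib-+ {suc n} f g = begin
  (f zero + g zero) + Σℤ (λ i → f (suc i) + g (suc i))
    ≡⟨ cong (_+_ (f zero + g zero)) (Σℤ-distrib-+ (λ i → f (suc i)) (λ i → g (suc i))) ⟩
  (f zero + g zero) + (Σℤ (λ i → f (suc i)) + Σℤ (λ i → g (suc i)))
    ≡⟨ middleFour (f zero) (g zero) _ _ ⟩
  (f zero + Σℤ (λ i → f (suc i))) + (g zero + Σℤ (λ i → g (suc i))) ∎
  where
  open ≡-Reasoning
  middleFour : ∀ a b c d → (a + b) + (c + d) ≡ (a + c) + (b + d)
  middleFour = solve-∀

Σℤ-distribʳ-* : (f : Fin n → ℤ) (c : ℤ) → Σℤ (λ i → f i * c) ≡ Σℤ f * c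
Σℤ-distribʳ-* {zero}  f c = refl
Σℤ-distribʳ-* {suc n} f c =
  trans (cong (_+_ (f zero * c)) (Σℤ-distribʳ-* (λ i → f (suc i)) c))
        (sym (ℤP.*-distribʳ-+ c (f zero) _))

Σℤ-+ : (m : Fin n → ℕ) → Σℤ (λ i → + m i) ≡ + Σℕ m
Σℤ-+ {zero}  m = refl
Σℤ-+ {suc n} m = cong (_+_ (+ m zero)) (Σℤ-+ (λ i → m (suc i)))

Σℤ-const-1 : ∀ n → Σℤ {n} (λ _ → 1ℤ) ≡ + n
Σℤ-const-1 zero    = refl
Σℤ-const-1 (suc n) = cong (_+_ 1ℤ) (Σℤ-const-1 n)

Σℤ-zero : (f : Fin n → ℤ) → (∀ i → f i ≡ 0ℤ) → Σℤ f ≡ 0ℤ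
Σℤ-zero {zero}  f f≗0 = refl
Σℤ-zero {suc n} f f≗0 =
  cong₂ _+_ (f≗0 zero) (Σℤ-zero (λ i → f (suc i)) (λ i → f≗0 (suc i)))

Σℤ-single : (f : Fin n → ℤ) (w : Fin n) → (∀ u → u ≢ w → f u ≡ 0ℤ) → Σℤ f ≡ f w
Σℤ-single {suc n} f zero f≗0 =
  trans (cong (_+_ (f zero)) (Σℤ-zero (λ i → f (suc i)) (λ i → f≗0 (suc i) λ ())))
        (ℤP.+-identityʳ (f zero))
Σℤ-single {suc n} f (suc w) f≗0 =
  trans (cong (_+ Σℤ (λ i → f (suc i))) (f≗0 zero λ ()))
        (trans (ℤP.+-identityˡ _) (Σℤ-single (λ i → f (suc i)) w (λ u u≢w → f≗0 (suc u) (u≢w ∘ suc-injective))))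

Σℤ-nonneg : (f : Fin n → ℤ) → (∀ i → 0ℤ ℤ.≤ f i) → 0ℤ ℤ.≤ Σℤ f
Σℤ-nonneg {zero}  f 0≤f = ℤP.≤-refl
Σℤ-nonneg {suc n} f 0≤f =
  ℤP.+-mono-≤ (0≤f zero) (Σℤ-nonneg (λ i → f (suc i)) (λ i → 0≤f (suc i)))

Σℤ-term-≤ : (f : Fin n → ℤ) → (∀ i → 0ℤ ℤ.≤ f i) → ∀ w → f w ℤ.≤ Σℤ f
Σℤ-term-≤ {suc n} f 0≤f zero =
  ℤP.i≤i+j (f zero) _ {{ℤ.nonNegative (Σℤ-nonneg (λ i → f (suc i)) (λ i → 0≤f (suc i)))}}
Σℤ-term-≤ {suc n} f 0≤f (suc w) =
  ℤP.i≤j⇒i≤k+j (f zero) {{ℤ.nonNegative (0≤f zero)}}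
    (Σℤ-term-≤ (λ i → f (suc i)) (λ i → 0≤f (suc i)) w)

pt : Fin n → Divisor n
pt v u with v ≟ u
... | yes _ = 1ℤ
... | no  _ = 0ℤ

pt-effective : (v : Fin n) → Effective (pt v)
pt-effective v u with v ≟ u
... | yes _ = ℤ.+≤+ ℕ.z≤n
... | no  _ = ℤ.+≤+ ℕ.z≤n

pt-self : (v : Fin n) → pt v v ≡ 1ℤ
pt-self v with v ≟ v
... | yes _   = refl
... | no  v≢v = ⊥-elim (v≢v refl)

pt-other : (v u : Fin n) → u ≢ v → pt v u ≡ 0ℤ
pt-other v u u≢v with v ≟ u
... | yes v≡u = ⊥-elim (u≢v (sym v≡u))
... | no  _   = refl

deg-pt : (v : Fin n) → deg (pt v) ≡ 1ℤ
deg-pt v = trans (Σℤ-single (pt v) v (pt-other v)) (pt-self v)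

Σℤ-pt-* : (v : Fin n) (c : ℤ) → Σℤ (λ u → pt v u * c) ≡ c
Σℤ-pt-* v c = begin
  Σℤ (λ u → pt v u * c) ≡⟨ Σℤ-single _ v (λ u u≢v → cong (_* c) (pt-other v u u≢v)) ⟩
  pt v v * c            ≡⟨ cong (_* c) (pt-self v) ⟩
  1ℤ * c                ≡⟨ ℤP.*-identityˡ c ⟩
  c                     ∎
  where open ≡-Reasoning

module _ (G : Multigraph n) where

  -- Shifted by mult(w,u)·f(w) so that summing over u only needs additivity of Σℤ.
  laplacian-row-term : (f : Fin n → ℤ) (w u : Fin n) →
    Laplacian G w u * f u + + mult G w u * f w
      ≡ pt w u * (+ valence G w * f w) + + mult G w u * (f w - f u)
  laplacian-row-term f w u with w ≟ u
  ... | yes refl = diagonal (+ valence G w) (+ mult G w w) (f w)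
    where
    diagonal : ∀ d m a → (d - m) * a + m * a ≡ 1ℤ * (d * a) + m * (a - a)
    diagonal = solve-∀
  ... | no  _    = offDiagonal (+ valence G w) (+ mult G w u) (f u) (f w)
    where
    offDiagonal : ∀ d m a b → (0ℤ - m) * a + m * b ≡ 0ℤ * (d * b) + m * (b - a)
    offDiagonal = solve-∀

  Σℤ-mult-* : (w : Fin n) (c : ℤ) → Σℤ (λ u → + mult G w u * c) ≡ + valence G w * c
  Σℤ-mult-* w c = trans (Σℤ-distribʳ-* (λ u → + mult G w u) c) (cong (_* c) (Σℤ-+ (mult G w)))

  applyLap≡Σ-edges : (f : Fin n → ℤ) (w : Fin n) →
    applyLap G f w ≡ Σℤ (λ u → + mult G w u * (f w - f u))
  applyLap≡Σ-edges f w = ∙-cancelʳ (+ valence G w * f w) _ _ (begin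
    Σℤ Lf + d
      ≡⟨ cong (_+_ (Σℤ Lf)) (sym (Σℤ-mult-* w (f w))) ⟩
    Σℤ Lf + Σℤ (λ u → + mult G w u * f w)
      ≡⟨ sym (Σℤ-distrib-+ Lf _) ⟩
    Σℤ (λ u → Lf u + + mult G w u * f w)
      ≡⟨ Σℤ-cong (laplacian-row-term f w) ⟩
    Σℤ (λ u → pt w u * d + edge u)
      ≡⟨ Σℤ-distrib-+ _ edge ⟩
    Σℤ (λ u → pt w u * d) + Σℤ edge
      ≡⟨ cong (_+ Σℤ edge) (Σℤ-pt-* w d) ⟩
    d + Σℤ edge
      ≡⟨ ℤP.+-comm d (Σℤ edge) ⟩
    Σℤ edge + d ∎)
    where
    open ≡-Reasoning
    d : ℤ
    d = + valence G w * f w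
    Lf edge : Fin n → ℤ
    Lf u = Laplacian G w u * f u
    edge u = + mult G w u * (f w - f u)

  applyLap-zero : (w : Fin n) → applyLap G (λ _ → 0ℤ) w ≡ 0ℤ
  applyLap-zero w = Σℤ-zero _ (λ u → ℤP.*-zeroʳ (Laplacian G w u))

edgeTerm-nonneg : ∀ m {a b} → a ℤ.≤ b → 0ℤ ℤ.≤ + m * (b - a)
edgeTerm-nonneg m {a} {b} a≤b =
  subst (ℤ._≤ + m * (b - a)) (ℤP.*-zeroʳ (+ m)) (ℤP.*-monoˡ-≤-nonNeg (+ m) (ℤP.i≤j⇒0≤j-i a≤b))

edgeTerm-≥2 : ∀ {m a b} → 2 ≤ m → a ℤ.< b → + 2 ℤ.≤ + m * (b - a)
edgeTerm-≥2 {m} {a} {b} 2≤m a<b = ℤP.≤-trans (ℤ.+≤+ 2≤m)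
  (subst (ℤ._≤ + m * (b - a)) (ℤP.*-identityʳ (+ m)) (ℤP.*-monoˡ-≤-nonNeg (+ m) 1≤b-a))
  where
  sucℤ-cancel : ∀ a → (1ℤ + a) - a ≡ 1ℤ
  sucℤ-cancel = solve-∀
  1≤b-a : 1ℤ ℤ.≤ b - a
  1≤b-a = subst (ℤ._≤ b - a) (sucℤ-cancel a) (ℤP.+-monoˡ-≤ (- a) (ℤP.i<j⇒suc[i]≤j a<b))

module _ (G : Multigraph n) (f : Fin n → ℤ) {w : Fin n} (w-max : ∀ u → f u ℤ.≤ f w) where

  private
    edgeTerms-nonneg : ∀ u → 0ℤ ℤ.≤ + mult G w u * (f w - f u)
    edgeTerms-nonneg u = edgeTerm-nonneg (mult G w u) (w-max u)

  applyLap-nonneg-atMax : 0ℤ ℤ.≤ applyLap G f w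
  applyLap-nonneg-atMax = subst (0ℤ ℤ.≤_) (sym (applyLap≡Σ-edges G f w))
    (Σℤ-nonneg _ edgeTerms-nonneg)

  edgeTerm-≤-applyLap-atMax : ∀ x → + mult G w x * (f w - f x) ℤ.≤ applyLap G f w
  edgeTerm-≤-applyLap-atMax x = subst (_ ℤ.≤_) (sym (applyLap≡Σ-edges G f w))
    (Σℤ-term-≤ _ edgeTerms-nonneg x)

Reach-exit : ∀ {p} {G : Multigraph n} {P : Pred (Fin n) p} → Decidable P →
             ∀ {u v} → Reach G u v → P u → ¬ P v →
             ∃₂ λ w x → P w × 1 ≤ mult G w x × ¬ P x
Reach-exit P? here                    Pu ¬Pv = ⊥-elim (¬Pv Pu)
Reach-exit P? (step {w = w} u–w w⇝v) Pu ¬Pv with P? w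
... | yes Pw = Reach-exit P? w⇝v Pw ¬Pv
... | no ¬Pw = _ , w , Pu , u–w , ¬Pw

f≤f[argmax] : (f : Fin n → ℤ) (v₀ u : Fin n) → f u ℤ.≤ f (argmax f v₀ (allFin n))
f≤f[argmax] f v₀ u = lookup (f[xs]≤f[argmax] v₀ (allFin _)) (∈-allFin u)

NoSimpleEdges : Multigraph n → Set
NoSimpleEdges G = ∀ u v → 1 ≤ mult G u v → 2 ≤ mult G u v

effective⇒equivEffective : (G : Multigraph n) {D : Divisor n} → Effective D → EquivEffective G D
effective⇒equivEffective G {D} D-eff =
  D , D-eff , (λ _ → 0ℤ) , λ v → trans (ℤP.+-inverseʳ (D v)) (sym (applyLap-zero G v))

module _ {G : Multigraph n} (reach : ∀ u v → Reach G u v) (noSimple : NoSimpleEdges G) where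

  ≤1∧equivEffective⇒effective : {D : Divisor n} → (∀ v → D v ℤ.≤ 1ℤ) →
                                EquivEffective G D → Effective D
  ≤1∧equivEffective⇒effective {D} D≤1 (D' , D'-eff , f , D-D'≡Lf) v = byMaximality (f v ℤ.≟ f top)
    where
    top : Fin n
    top = argmax f v (allFin n)

    Lf≤D : ∀ u → applyLap G f u ℤ.≤ D u
    Lf≤D u = subst (ℤ._≤ D u) (D-D'≡Lf u) (ℤP.i-j≤i (D u) (D' u) {{ℤ.nonNegative (D'-eff u)}})

    atMax : ∀ {u} → f u ≡ f top → ∀ y → f y ℤ.≤ f u
    atMax fu≡max y = subst (f y ℤ.≤_) (sym fu≡max) (f≤f[argmax] f v y)

    2≰1 : ¬ (+ 2 ℤ.≤ 1ℤ)
    2≰1 (ℤ.+≤+ (ℕ.s≤s ()))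

    byMaximality : Dec (f v ≡ f top) → 0ℤ ℤ.≤ D v
    byMaximality (yes v-max) = ℤP.≤-trans (applyLap-nonneg-atMax G f (atMax v-max)) (Lf≤D v)
    byMaximality (no v-notMax)
      with Reach-exit (λ u → f u ℤ.≟ f top) (reach top v) refl v-notMax
    ... | w , x , w-max , w–x , x-notMax = ⊥-elim (2≰1 (begin
      + 2                          ≤⟨ edgeTerm-≥2 (noSimple w x w–x) fx<fw ⟩
      + mult G w x * (f w - f x)   ≤⟨ edgeTerm-≤-applyLap-atMax G f (atMax w-max) x ⟩
      applyLap G f w               ≤⟨ Lf≤D w ⟩
      D w                          ≤⟨ D≤1 w ⟩
      1ℤ                           ∎))
      where
      open ℤP.≤-Reasoning
      fx<fw : f x ℤ.< f w
      fx<fw = ℤP.≤∧≢⇒< (atMax w-max x) (λ fx≡fw → x-notMax (trans fx≡fw w-max))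

  candidate⇒allOnes : {D : Divisor n} → MfgonCandidate G D → ∀ v → D v ≡ 1ℤ
  candidate⇒allOnes {D} (zeroOne , _ , rank≥1) v = ℤP.≤-antisym (proj₂ (zeroOne v)) 1≤Dv
    where
    D-v≤1 : ∀ u → (D -ᴰ pt v) u ℤ.≤ 1ℤ
    D-v≤1 u = ℤP.≤-trans (ℤP.i-j≤i (D u) (pt v u) {{ℤ.nonNegative (pt-effective v u)}})
                         (proj₂ (zeroOne u))

    D-v-effective : Effective (D -ᴰ pt v)
    D-v-effective = ≤1∧equivEffective⇒effective D-v≤1 (rank≥1 (pt v) (pt-effective v) (deg-pt v))

    1≤Dv : 1ℤ ℤ.≤ D v
    1≤Dv = ℤP.0≤i-j⇒j≤i (subst (λ c → 0ℤ ℤ.≤ D v - c) (pt-self v) (D-v-effective v))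

allOnes : Divisor n
allOnes _ = 1ℤ

allOnes-zeroOne : ZeroOne (allOnes {n})
allOnes-zeroOne _ = ℤ.+≤+ ℕ.z≤n , ℤP.≤-refl

deg-allOnes : ∀ n → deg (allOnes {n}) ≡ + n
deg-allOnes = Σℤ-const-1

allOnes-positiveRank : (G : Multigraph n) → PositiveRank G allOnes
allOnes-positiveRank G = effective⇒equivEffective G (λ v → proj₁ (allOnes-zeroOne v)) , minusPt
  where
  minusPt : RankAtLeast G allOnes 1
  minusPt E E-eff deg≡1 = effective⇒equivEffective G λ u →
    ℤP.i≤j⇒0≤j-i (subst (E u ℤ.≤_) deg≡1 (Σℤ-term-≤ E E-eff u))

lemma2p6 : (n : ℕ) (G : Multigraph n) → Connected G →
           (∀ u v → 1 ≤ mult G u v → 2 ≤ mult G u v) →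
           MfgonIs G n
lemma2p6 n G (_ , reach) noSimple =
  (allOnes , (allOnes-zeroOne , allOnes-positiveRank G) , deg-allOnes n) , minimal
  where
  minimal : ∀ D → MfgonCandidate G D → + n ℤ.≤ deg D
  minimal D candidate = ℤP.≤-reflexive (sym (begin
    deg D             ≡⟨ Σℤ-cong (candidate⇒allOnes reach noSimple candidate) ⟩
    deg (allOnes {n}) ≡⟨ deg-allOnes n ⟩
    + n               ∎))
    where open ≡-Reasoning
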